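{- Let $q\ge2$, $n\ge 2$, and let $\mathbf{u}=(u_0,\ldots,u_{n-1})$ be an $n$-tuple over $\mathbb{Z}_q$ that is both negasymmetric and $(n-1)$-negasymmetric. Then all entries of $\mathbf{u}$ equal a common value $c$, where $c=0$ or $c=q/2$ (the latter possible only if $q$ is even).
   Context: A $k$-tuple $(u_0,\ldots,u_{k-1})$ over $\mathbb{Z}_q$ is negasymmetric if $u_i=-u_{k-1-i}$ for all $0\le i\le k-1$. An $n$-tuple $\mathbf{u}=(u_0,\ldots,u_{n-1})$ is $m$-negasymmetric ($m\le n$) if the $m$-tuple $(u_0,\ldots,u_{m-1})$ is negasymmetric. -}

module Defs where

open import Data.Nat using (ℕ; zero; suc; _+_; _*_; _∸_; _%_; _≤_; _<_; NonZero)

open import Data.Fin using (Fin; toℕ; opposite; inject≤)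
open import Relation.Binary.PropositionalEquality using (_≡_)

-- Z_q is modelled as Fin q (residues 0..q-1); arithmetic mod q via toℕ.
-- Negation in Z_q: y = -x  iff  x + y ≡ 0 (mod q).
IsNeg : {q : ℕ} → .{{NonZero q}} → Fin q → Fin q → Set
IsNeg {q} x y = (toℕ x + toℕ y) % q ≡ 0

Negasymmetric : {q k : ℕ} → .{{NonZero q}} → (Fin k → Fin q) → Set
Negasymmetric {q} {k} u = ∀ (i : Fin k) → IsNeg (u i) (u (opposite i))

MNegasymmetric : {q n : ℕ} → .{{NonZero q}} → (m : ℕ) → m ≤ n → (Fin n → Fin q) → Set
MNegasymmetric {q} {n} m m≤n u =
  Negasymmetric (λ (i : Fin m) → u (inject≤ i m≤n))

{-# OPTIONS --safe #-}
-- Both u (n-1-i) and u (n-2-i) are the negative of u i, and negatives in ℤ_q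
-- are unique, so consecutive entries agree.  Hence u is constant with value c,
-- and negasymmetry gives c = -c, i.e. 2c ∈ {0, q}.
module Submission where

open import Defs
open import Data.Nat using (ℕ; zero; suc; _+_; _*_; _∸_; _%_; _≤_; _<_; _≥_; NonZero; s≤s; z≤n)
open import Data.Nat.Properties using (m∸n≤m; +-comm; +-assoc; +-identityʳ; m+n≡0⇒m≡0; *-monoˡ-≤; *-monoʳ-<; <⇒≱)
open import Data.Nat.DivMod using (%-distribˡ-+; m%n%n≡m%n; m<n⇒m%n≡m)
open import Data.Nat.Divisibility using (_∣_; divides; m%n≡0⇒n∣m)
open import Data.Fin using (Fin; zero; suc; toℕ; inject₁; inject≤; opposite)
open import Data.Fin.Properties using (toℕ-injective; toℕ<n; opposite-involutive)
open import Data.Product using (Σ; _×_; _,_)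
open import Data.Sum using (_⊎_; inj₁; inj₂; map₁)
open import Data.Empty using (⊥-elim)
open import Function using (_∘_)
open import Relation.Binary.PropositionalEquality using (_≡_; refl; sym; trans; cong; subst; subst₂; module ≡-Reasoning)

open ≡-Reasoning

%-absorbʳ : ∀ m {n d} .{{_ : NonZero d}} → n % d ≡ 0 → (m + n) % d ≡ m % d
%-absorbʳ m {n} {d} n%d≡0 = begin
  (m + n) % d           ≡⟨ %-distribˡ-+ m n d ⟩
  (m % d + n % d) % d   ≡⟨ cong (λ r → (m % d + r) % d) n%d≡0 ⟩
  (m % d + 0) % d       ≡⟨ cong (_% d) (+-identityʳ (m % d)) ⟩
  m % d % d             ≡⟨ m%n%n≡m%n m d ⟩
  m % d                 ∎

multiple<2*⇒0⊎self : ∀ {q s} → q ∣ s → s < 2 * q → s ≡ 0 ⊎ s ≡ q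
multiple<2*⇒0⊎self     (divides zero refl)          _ = inj₁ refl
multiple<2*⇒0⊎self {q} (divides (suc zero) refl)    _ = inj₂ (+-identityʳ q)
multiple<2*⇒0⊎self {q} (divides (suc (suc k)) refl) s<2q =
  ⊥-elim (<⇒≱ s<2q (*-monoˡ-≤ q (s≤s (s≤s (z≤n {k})))))

module _ {q : ℕ} .{{_ : NonZero q}} where

  IsNeg-unique : {x y z : Fin q} → IsNeg x y → IsNeg x z → y ≡ z
  IsNeg-unique {x} {y} {z} x+y≡0 x+z≡0 = toℕ-injective (begin
    toℕ y                             ≡⟨ m<n⇒m%n≡m (toℕ<n y) ⟨
    toℕ y % q                         ≡⟨ %-absorbʳ (toℕ y) x+z≡0 ⟨
    (toℕ y + (toℕ x + toℕ z)) % q     ≡⟨ cong (_% q) (swap (toℕ y) (toℕ x) (toℕ z)) ⟩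
    (toℕ z + (toℕ x + toℕ y)) % q     ≡⟨ %-absorbʳ (toℕ z) x+y≡0 ⟩
    toℕ z % q                         ≡⟨ m<n⇒m%n≡m (toℕ<n z) ⟩
    toℕ z                             ∎)
    where
    swap : ∀ a b c → a + (b + c) ≡ c + (b + a)
    swap a b c = trans (sym (+-assoc a b c)) (trans (+-comm (a + b) c) (cong (c +_) (+-comm a b)))

  IsNeg-self : {c : Fin q} → IsNeg c c → toℕ c ≡ 0 ⊎ 2 * toℕ c ≡ q
  IsNeg-self {c} c+c≡0 =
    map₁ (m+n≡0⇒m≡0 (toℕ c)) (multiple<2*⇒0⊎self (m%n≡0⇒n∣m (2 * toℕ c) q 2c%q≡0) (*-monoʳ-< 2 (toℕ<n c)))
    where
    2c%q≡0 : (2 * toℕ c) % q ≡ 0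
    2c%q≡0 = subst (λ r → (toℕ c + r) % q ≡ 0) (sym (+-identityʳ (toℕ c))) c+c≡0

opposite-inject₁ : ∀ {n} (i : Fin n) → opposite (inject₁ i) ≡ suc (opposite i)
opposite-inject₁ zero    = refl
opposite-inject₁ (suc i) = cong inject₁ (opposite-inject₁ i)

inject≤-inject₁ : ∀ {n} (i : Fin n) .(n≤1+n : n ≤ suc n) → inject≤ i n≤1+n ≡ inject₁ i
inject≤-inject₁ zero    _ = refl
inject≤-inject₁ (suc i) _ = cong suc (inject≤-inject₁ i _)

steps-constant : ∀ {a} {A : Set a} {n} (u : Fin (suc n) → A) →
  (∀ k → u (suc k) ≡ u (inject₁ k)) → ∀ i → u i ≡ u zero
steps-constant             u step zero    = refl
steps-constant {n = suc n} u step (suc k) =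
  trans (step k) (steps-constant (u ∘ inject₁) (step ∘ inject₁) k)

module _ {q : ℕ} .{{_ : NonZero q}} {m : ℕ} (u : Fin (suc (suc m)) → Fin q) where

  MNegasymmetric⇒Negasymmetric-inject₁ : (p : suc m ≤ suc (suc m)) →
    MNegasymmetric (suc m) p u → Negasymmetric (u ∘ inject₁)
  MNegasymmetric⇒Negasymmetric-inject₁ p pre j =
    subst₂ (λ a b → IsNeg (u a) (u b)) (inject≤-inject₁ j p) (inject≤-inject₁ (opposite j) p) (pre j)

  Negasymmetric-neighbours : Negasymmetric u → Negasymmetric (u ∘ inject₁) →
    ∀ k → u (suc k) ≡ u (inject₁ k)
  Negasymmetric-neighbours neg neg′ k = begin
    u (suc k)                  ≡⟨ cong (u ∘ suc) (opposite-involutive k) ⟨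
    u (suc (opposite j))       ≡⟨ cong u (opposite-inject₁ j) ⟨
    u (opposite (inject₁ j))   ≡⟨ IsNeg-unique (neg (inject₁ j)) (neg′ j) ⟩
    u (inject₁ (opposite j))   ≡⟨ cong (u ∘ inject₁) (opposite-involutive k) ⟩
    u (inject₁ k)              ∎
    where
    j = opposite k

lemma3 : (q n : ℕ) → .{{_ : NonZero q}} → q ≥ 2 → n ≥ 2 →
    (u : Fin n → Fin q) → Negasymmetric u → MNegasymmetric (n ∸ 1) (m∸n≤m n 1) u →
    Σ (Fin q) (λ c → ((i : Fin n) → u i ≡ c) × (toℕ c ≡ 0 ⊎ 2 * toℕ c ≡ q))
lemma3 q (suc (suc m)) _ (s≤s (s≤s _)) u neg pre = u zero , constant , IsNeg-self middle
  where
  constant : ∀ i → u i ≡ u zero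
  constant = steps-constant u
    (Negasymmetric-neighbours u neg (MNegasymmetric⇒Negasymmetric-inject₁ u (m∸n≤m (suc (suc m)) 1) pre))

  middle : IsNeg (u zero) (u zero)
  middle = subst (IsNeg (u zero)) (constant (opposite zero)) (neg zero)
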